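{- Let $(H,\omega)$ be an edge-weighted graph with positive integer weights and let $(G,\mathcal S)=(G(H,\omega),\mathcal S(H,\omega))$. Let $(A,B)$ be an $\mathcal S$-cut of $G$ and let $M$ be a semi-induced matching of $G$ between $A$ and $B$ consisting only of matching edges. Then there is a single part $S(w)\in\mathcal S$ that covers all edges of $M$ (every edge of $M$ has an endpoint in $S(w)$).
   Context: Construction of $(G(H,\omega),\mathcal S(H,\omega))$: for each ordered pair $(u,v)$ with $uv\in E(H)$, add an independent set $I(u,v)$ of $\omega(uv)$ new vertices; let $S(u)=\bigcup_{v\in N_H(u)}I(u,v)$ and $\mathcal S=\{S(u):u\in V(H)\}$. Dummy edges: for every two edges $uv,xy$ of $H$ sharing no endpoint, every vertex of $I(u,v)$ is joined to every vertex of $I(x,y)$ (for all orientations). Matching edges: for every $uv\in E(H)$, a perfect matching between $I(u,v)$ and $I(v,u)$. These are all the edges of $G$. An $\mathcal S$-cut is a bipartition $(A,B)$ of $V(G)$ such that each part of $\mathcal S$ lies in $A$ or in $B$. A semi-induced matching between $A$ and $B$ is a matching whose edges go between $A$ and $B$ and which is an induced matching of the bipartite graph formed by the edges of $G$ between $A$ and $B$. -}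

module Defs where

open import Data.Nat using (ℕ; _≤_; _<_)
open import Data.Fin using (Fin)
open import Data.Bool using (Bool; true; false; T)
open import Data.Product using (Σ; _×_; _,_)
open import Data.Sum using (_⊎_)
open import Relation.Binary.PropositionalEquality using (_≡_; _≢_; subst)
open import Relation.Nullary using (¬_)

record WGraph : Set where
  field
    n       : ℕ
    adj     : Fin n → Fin n → Bool
    adj-sym : ∀ u v → adj u v ≡ adj v u
    irrefl  : ∀ u → adj u u ≡ false
    ω       : Fin n → Fin n → ℕ          -- only meaningful on edges
    ω-sym   : ∀ u v → ω u v ≡ ω v u
    ω-pos   : ∀ u v → T (adj u v) → 1 ≤ ω u v

open WGraph public

-- The perfect matchings between I(u,v) and I(v,u), given as bijections
-- σ u v : I(u,v) → I(v,u) with σ v u the inverse of σ u v.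
record MatchingData (H : WGraph) : Set where
  field
    σ     : ∀ u v → Fin (ω H u v) → Fin (ω H v u)
    σ-inv : ∀ u v (i : Fin (ω H u v)) → σ v u (σ u v i) ≡ i

open MatchingData public

-- Vertices of G(H,ω): the vertex number i of I(u,v), for an edge uv of H.
record GVertex (H : WGraph) : Set where
  constructor gv
  field
    tail : Fin (n H)
    head : Fin (n H)
    edge : T (adj H tail head)
    idx  : Fin (ω H tail head)

open GVertex public

-- The vertex lies in the part S(owner a) of 𝒮.
owner : {H : WGraph} → GVertex H → Fin (n H)
owner a = tail a

partner : {H : WGraph} → MatchingData H → GVertex H → GVertex H
partner {H} μ (gv u v e i) = gv v u (subst T (adj-sym H u v) e) (σ μ u v i)

MatchEdge : {H : WGraph} → MatchingData H → GVertex H → GVertex H → Set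
MatchEdge μ a b = (b ≡ partner μ a) ⊎ (a ≡ partner μ b)

DummyEdge : {H : WGraph} → GVertex H → GVertex H → Set
DummyEdge a b =
  (tail a ≢ tail b) × (tail a ≢ head b) × (head a ≢ tail b) × (head a ≢ head b)

GEdge : {H : WGraph} → MatchingData H → GVertex H → GVertex H → Set
GEdge μ a b = DummyEdge a b ⊎ MatchEdge μ a b

-- An 𝒮-cut (A,B): side a ≡ true means a ∈ A, false means a ∈ B;
-- every part S(w) lies entirely in A or entirely in B.
IsSCut : {H : WGraph} → (GVertex H → Bool) → Set
IsSCut side = ∀ a b → owner a ≡ owner b → side a ≡ side b

record SemiInducedMatchingEdges {H : WGraph} (μ : MatchingData H)
       (side : GVertex H → Bool) (k : ℕ)
       (ea eb : Fin k → GVertex H) : Set where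
  field
    inA       : ∀ i → side (ea i) ≡ true
    inB       : ∀ i → side (eb i) ≡ false
    isEdge    : ∀ i → GEdge μ (ea i) (eb i)
    isMatchE  : ∀ i → MatchEdge μ (ea i) (eb i)
    disjointA : ∀ i j → i ≢ j → ea i ≢ ea j
    disjointB : ∀ i j → i ≢ j → eb i ≢ eb j
    -- induced in the bipartite graph of G-edges between A and B
    induced   : ∀ i j → i ≢ j → ¬ GEdge μ (ea i) (eb j)

{-# OPTIONS --safe #-}
module Submission where

-- Write pᵢ = owner (ea i) and qᵢ = owner (eb i); the i-th edge of M runs between
-- I(pᵢ,qᵢ) and I(qᵢ,pᵢ). Since (A,B) is an 𝒮-cut, no pᵢ equals any qⱼ. If for
-- some i, j both pᵢ ≠ pⱼ and qᵢ ≠ qⱼ, then the H-edges pᵢqᵢ and qⱼpⱼ are disjoint,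
-- so ea i and eb j are joined by a dummy edge, against inducedness. Hence any two
-- edges of M agree in p or in q, and then all of them agree in p or all in q.

open import Defs
open import Data.Nat using (ℕ; suc; _<_)
open import Data.Fin using (Fin; zero; fromℕ<)
open import Data.Fin.Properties using (all?; ¬∀⟶∃¬) renaming (_≟_ to _≟ᶠ_)
open import Data.Bool using (Bool; true; false)
open import Data.Product using (Σ; _×_; _,_; proj₁; proj₂)
open import Data.Sum using (_⊎_; inj₁; inj₂)
open import Function using (_∘_)
open import Relation.Nullary using (yes; no)
open import Relation.Nullary.Decidable using (decidable-stable)
open import Relation.Binary.Definitions using (DecidableEquality)
open import Relation.Binary.PropositionalEquality using (_≡_; _≢_; refl; sym; trans)

constant-or-constant : {X Y : Set} → DecidableEquality X → {k : ℕ}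
                     → (p : Fin (suc k) → X) (q : Fin (suc k) → Y)
                     → (∀ i j → p i ≢ p j → q i ≡ q j)
                     → (∀ i → p i ≡ p zero) ⊎ (∀ i → q i ≡ q zero)
constant-or-constant _≟_ {k} p q p≢⇒q≡ with all? (λ i → p i ≟ p zero)
... | yes p-constant = inj₁ p-constant
... | no ¬p-constant with ¬∀⟶∃¬ (suc k) _ (λ i → p i ≟ p zero) ¬p-constant
...   | j , pj≢p₀ = inj₂ q-constant
  where
  q-constant : ∀ i → q i ≡ q zero
  q-constant i with p i ≟ p zero
  ... | no pi≢p₀ = p≢⇒q≡ i zero pi≢p₀
  ... | yes pi≡p₀ =
    trans (p≢⇒q≡ i j (λ pi≡pj → pj≢p₀ (trans (sym pi≡pj) pi≡p₀)))
          (p≢⇒q≡ j zero pj≢p₀)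

matchEdge-reverses : {H : WGraph} (μ : MatchingData H) {a b : GVertex H}
                   → MatchEdge μ a b → (tail b ≡ head a) × (head b ≡ tail a)
matchEdge-reverses μ {gv u v e i} (inj₁ refl) = refl , refl
matchEdge-reverses μ {b = gv u v e i} (inj₂ refl) = refl , refl

sCut-separates : {H : WGraph} {side : GVertex H → Bool} → IsSCut side
               → {a b : GVertex H} → side a ≡ true → side b ≡ false
               → owner a ≢ owner b
sCut-separates cut {a} {b} a∈A b∈B same-owner
  with trans (sym a∈A) (trans (cut a b same-owner) b∈B)
... | ()

module _ {H : WGraph} {μ : MatchingData H} {side : GVertex H → Bool} (cut : IsSCut side)
         {k : ℕ} {ea eb : Fin k → GVertex H} (M : SemiInducedMatchingEdges μ side k ea eb)
  where
  open SemiInducedMatchingEdges M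

  A-owners-differ⇒B-owners-agree : ∀ i j → owner (ea i) ≢ owner (ea j)
                                 → owner (eb i) ≡ owner (eb j)
  A-owners-differ⇒B-owners-agree i j pi≢pj =
    decidable-stable (owner (eb i) ≟ᶠ owner (eb j)) λ qi≢qj →
      induced i j (λ { refl → pi≢pj refl }) (inj₁ (dummy-edge qi≢qj))
    where
    tail-ebᵢ : tail (eb i) ≡ head (ea i)
    tail-ebᵢ = proj₁ (matchEdge-reverses μ (isMatchE i))
    head-ebⱼ : head (eb j) ≡ tail (ea j)
    head-ebⱼ = proj₂ (matchEdge-reverses μ (isMatchE j))

    dummy-edge : owner (eb i) ≢ owner (eb j) → DummyEdge (ea i) (eb j)
    dummy-edge qi≢qj =
      sCut-separates cut (inA i) (inB j) ,
      (λ e → pi≢pj (trans e head-ebⱼ)) ,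
      (λ e → qi≢qj (trans tail-ebᵢ e)) ,
      (λ e → sCut-separates cut (inA j) (inB i) (sym (trans tail-ebᵢ (trans e head-ebⱼ))))

lemma19 : (H : WGraph) → 0 < n H → (μ : MatchingData H)
          → (side : GVertex H → Bool) → IsSCut side
          → (k : ℕ) (ea eb : Fin k → GVertex H)
          → SemiInducedMatchingEdges μ side k ea eb
          → Σ (Fin (n H)) (λ w → ∀ i → (owner (ea i) ≡ w) ⊎ (owner (eb i) ≡ w))
lemma19 H 0<n μ side cut 0 ea eb M = fromℕ< 0<n , λ ()
lemma19 H 0<n μ side cut (suc k) ea eb M
  with constant-or-constant _≟ᶠ_ (owner ∘ ea) (owner ∘ eb)
                            (A-owners-differ⇒B-owners-agree cut M)
... | inj₁ A-owner-constant = owner (ea zero) , λ i → inj₁ (A-owner-constant i)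
... | inj₂ B-owner-constant = owner (eb zero) , λ i → inj₂ (B-owner-constant i)
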